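{- Let $G$ be a tree-path intersection graph with the rooting and order $\le$ described in the context. If $s_1,s_2$ are vertices of $G$ with $\Gamma(s_1)\cap\Gamma(s_2)\neq\emptyset$, then $\min\Gamma(s_1)$ and $\min\Gamma(s_2)$ are comparable.
   Context: A tree-path intersection graph is a connected bipartite graph $G$ with disjoint parts $G_H$, $G_V$, together with a tree $T_H$ on vertex set $G_H$ and a tree $T_V$ on vertex set $G_V$, such that for every $h\in G_H$ the neighbourhood $\Gamma(h)$ of $h$ in $G$ is the vertex set of a path in $T_V$, and for every $v\in G_V$ the neighbourhood $\Gamma(v)$ is the vertex set of a path in $T_H$. Fix an edge $h_{\mathrm{root}}v_{\mathrm{root}}\in E(G)$ such that $v_{\mathrm{root}}$ is a leaf of $T_V$; root $T_H$ at $h_{\mathrm{root}}$ and $T_V$ at $v_{\mathrm{root}}$. For $s_1,s_2$ both in $G_H$ (resp. both in $G_V$), $s_1\le s_2$ iff $s_1$ lies on the path of $T_H$ (resp. $T_V$) from the root to $s_2$; vertices from different sides are incomparable; $s_1,s_2$ are comparable if $s_1\le s_2$ or $s_2\le s_1$. $\min\Gamma(s)$ denotes the unique $\le$-minimal element of $\Gamma(s)$ (it exists since $\Gamma(s)$ is a path in a rooted tree). -}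

module Defs where

open import Data.Nat using (ℕ; _≤_)
open import Data.Fin using (Fin)
open import Data.List using (List; []; _∷_; length; head; last)
open import Data.List.Membership.Propositional using (_∈_)
open import Data.List.Relation.Unary.Unique.Propositional using (Unique)
open import Data.List.Relation.Unary.Linked using (Linked)
open import Data.Maybe using (just)
open import Data.Sum using (_⊎_; inj₁; inj₂)
open import Data.Product using (Σ; ∃; _×_; _,_)
open import Data.Empty using (⊥)
open import Relation.Nullary using (¬_)
open import Relation.Binary.PropositionalEquality using (_≡_; _≢_)

module _ {A : Set} (Adj : A → A → Set) where

  IsPath : List A → Set
  IsPath xs = xs ≢ [] × Linked Adj xs × Unique xs

  PathFromTo : A → A → List A → Set
  PathFromTo u v xs = IsPath xs × head xs ≡ just u × last xs ≡ just v

  Connected : Set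
  Connected = ∀ u v → ∃ λ xs → PathFromTo u v xs

  Acyclic : Set
  Acyclic = ∀ x y xs → IsPath (x ∷ xs) → 2 ≤ length xs →
            last (x ∷ xs) ≡ just y → ¬ Adj y x

  record IsTree : Set where
    field
      adj-sym     : ∀ {x y} → Adj x y → Adj y x
      adj-irrefl  : ∀ {x} → ¬ Adj x x
      connected   : Connected
      acyclic     : Acyclic

  IsPathVertexSet : (A → Set) → Set
  IsPathVertexSet S = ∃ λ xs → IsPath xs × (∀ x → (S x → x ∈ xs) × (x ∈ xs → S x))

  IsLeaf : A → Set
  IsLeaf v = ∀ x y → Adj v x → Adj v y → x ≡ y

  BelowFrom : A → A → A → Set
  BelowFrom root a b = ∃ λ xs → PathFromTo root b xs × a ∈ xs

-- Tree-path intersection graphs, with G_H = Fin nH and G_V = Fin nV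

Vertex : ℕ → ℕ → Set
Vertex nH nV = Fin nH ⊎ Fin nV

BipAdj : ∀ {nH nV} → (Fin nH → Fin nV → Set) → Vertex nH nV → Vertex nH nV → Set
BipAdj E (inj₁ h) (inj₁ h′) = ⊥
BipAdj E (inj₁ h) (inj₂ v)  = E h v
BipAdj E (inj₂ v) (inj₁ h)  = E h v
BipAdj E (inj₂ v) (inj₂ v′) = ⊥

record RootedTPIG (nH nV : ℕ) : Set₁ where
  field
    E      : Fin nH → Fin nV → Set
    G-connected : Connected (BipAdj E)
    AdjH   : Fin nH → Fin nH → Set
    AdjV   : Fin nV → Fin nV → Set
    treeH  : IsTree AdjH
    treeV  : IsTree AdjV
    ΓH-path : ∀ h → IsPathVertexSet AdjV (λ v → E h v)
    ΓV-path : ∀ v → IsPathVertexSet AdjH (λ h → E h v)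
    hroot  : Fin nH
    vroot  : Fin nV
    root-edge : E hroot vroot
    vroot-leaf : IsLeaf AdjV vroot

module _ {nH nV : ℕ} (G : RootedTPIG nH nV) where
  open RootedTPIG G

  Γ : Vertex nH nV → Vertex nH nV → Set
  Γ s t = BipAdj E s t

  _≼_ : Vertex nH nV → Vertex nH nV → Set
  inj₁ a ≼ inj₁ b = BelowFrom AdjH hroot a b
  inj₂ a ≼ inj₂ b = BelowFrom AdjV vroot a b
  inj₁ _ ≼ inj₂ _ = ⊥
  inj₂ _ ≼ inj₁ _ = ⊥

  Comparable : Vertex nH nV → Vertex nH nV → Set
  Comparable a b = a ≼ b ⊎ b ≼ a

  IsMinΓ : Vertex nH nV → Vertex nH nV → Set
  IsMinΓ s m = Γ s m × (∀ x → Γ s x → x ≼ m → x ≡ m)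

{-# OPTIONS --safe #-}
module Submission where

-- Take a path r in the tree from the root to a common neighbour x of s₁ and s₂. The first
-- vertex z of r lying in the path Γ(sᵢ) is joined to min Γ(sᵢ) by the part of r before z
-- followed by a path inside Γ(sᵢ); hence z ≤ min Γ(sᵢ), so z = min Γ(sᵢ) and both minima
-- lie on r, where any two vertices are comparable.

open import Defs
open import Data.Product using (∃; ∃₂; _×_; _,_; proj₁; proj₂)
open import Data.Sum using (_⊎_; inj₁; inj₂)
import Data.Sum as Sum
open import Data.Sum.Properties using (inj₁-injective; inj₂-injective)
open import Data.Empty using (⊥-elim)
open import Data.Maybe using (just)
open import Data.List using (List; []; _∷_; _++_; _∷ʳ_; head; last)
open import Data.List.Membership.Propositional using (_∈_; _∉_)
open import Data.List.Membership.Propositional.Properties using (∈-++⁻; ∈-++⁺ʳ)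
import Data.List.Membership.DecPropositional as DecMembership
open import Data.List.Relation.Binary.Subset.Propositional using (_⊆_)
open import Data.List.Relation.Unary.Any using (here; there)
import Data.List.Relation.Unary.All as All
open import Data.List.Relation.Unary.All.Properties using (¬Any⇒All¬)
open import Data.List.Relation.Unary.Linked using (Linked; [-]; _∷_)
open import Data.List.Relation.Unary.Unique.Propositional using (Unique; []; _∷_)
open import Data.List.Relation.Unary.Unique.Propositional.Properties
  using (++⁺; Unique[x∷xs]⇒x∉xs)
open import Data.Fin.Properties using () renaming (_≟_ to _≟ᶠ_)
open import Function using (_∘_)
open import Relation.Nullary using (¬_; yes; no)
open import Relation.Binary.Definitions using (DecidableEquality; Symmetric)
open import Relation.Binary.PropositionalEquality using (_≡_; refl; subst)

unique-∷ : ∀ {A : Set} {x : A} {xs} → x ∉ xs → Unique xs → Unique (x ∷ xs)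
unique-∷ x∉xs u = ¬Any⇒All¬ _ x∉xs ∷ u

unique-∷ʳ : ∀ {A : Set} {x : A} {xs} → x ∉ xs → Unique xs → Unique (xs ∷ʳ x)
unique-∷ʳ x∉xs u = ++⁺ u (All.[] ∷ []) λ { (x∈xs , here refl) → x∉xs x∈xs }

∉-++ : ∀ {A : Set} {x : A} xs {ys} → x ∉ xs → x ∉ ys → x ∉ xs ++ ys
∉-++ xs x∉xs x∉ys x∈ = Sum.[ x∉xs , x∉ys ] (∈-++⁻ xs x∈)

module Walks {A : Set} (R : A → A → Set) where

  data Walk : A → A → List A → Set where
    [_] : ∀ u → Walk u u (u ∷ [])
    _∷_ : ∀ {u w v xs} → R u w → Walk w v xs → Walk u v (u ∷ xs)

  Path : A → A → List A → Set
  Path u v xs = Walk u v xs × Unique xs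

  PathWithin : List A → A → A → List A → Set
  PathWithin zs u v xs = Path u v xs × xs ⊆ zs

  BelowWithin : List A → A → A → A → Set
  BelowWithin zs root a b = ∃ λ xs → PathWithin zs root b xs × a ∈ xs

  ConnectedIn : List A → Set
  ConnectedIn zs = ∀ {u v} → u ∈ zs → v ∈ zs → ∃ (PathWithin zs u v)

  IsMinimalFrom : A → (A → Set) → A → Set
  IsMinimalFrom root S m = S m × (∀ x → S x → BelowFrom R root x m → x ≡ m)

  variable
    u v w a b m z : A
    xs ys zs : List A
    S S₁ S₂ : A → Set

  walk-head : Walk u v xs → u ∈ xs
  walk-head [ u ]   = here refl
  walk-head (_ ∷ _) = here refl

  walk-start : ∀ {x} → Walk u v (x ∷ xs) → u ≡ x
  walk-start [ _ ]   = refl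
  walk-start (_ ∷ _) = refl

  walk-∷ʳ : Walk u w xs → R w v → Walk u v (xs ∷ʳ v)
  walk-∷ʳ [ u ]     e = e ∷ [ _ ]
  walk-∷ʳ (e′ ∷ p) e = e′ ∷ walk-∷ʳ p e

  walk⇒linked : Walk u v xs → Linked R xs × head xs ≡ just u × last xs ≡ just v
  walk⇒linked [ u ]           = [-] , refl , refl
  walk⇒linked (e ∷ [ _ ])     = e ∷ [-] , refl , refl
  walk⇒linked (e ∷ p@(_ ∷ _)) with l , _ , last≡ ← walk⇒linked p = e ∷ l , refl , last≡

  linked⇒walk : ∀ xs → Linked R xs → head xs ≡ just u → last xs ≡ just v → Walk u v xs
  linked⇒walk (x ∷ [])     _       refl refl  = [ x ]
  linked⇒walk (x ∷ y ∷ xs) (e ∷ l) refl last≡ = e ∷ linked⇒walk (y ∷ xs) l refl last≡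

  linked⇒walkFrom : ∀ x xs → Linked R (x ∷ xs) → ∃ λ v → Walk x v (x ∷ xs)
  linked⇒walkFrom x []       _       = x , [ x ]
  linked⇒walkFrom x (y ∷ xs) (e ∷ l) with v , p ← linked⇒walkFrom y xs l = v , e ∷ p

  isPath⇒path : IsPath R xs → ∃₂ λ u v → Path u v xs
  isPath⇒path {[]}     (xs≢[] , _) = ⊥-elim (xs≢[] refl)
  isPath⇒path {x ∷ xs} (_ , l , uniq) with v , p ← linked⇒walkFrom x xs l = x , v , p , uniq

  path⇒pathFromTo : Path u v xs → PathFromTo R u v xs
  path⇒pathFromTo (p , uniq) with l , head≡ , last≡ ← walk⇒linked p =
    (nonempty p , l , uniq) , head≡ , last≡
    where
    nonempty : Walk u v xs → ¬ xs ≡ []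
    nonempty [ _ ]   ()
    nonempty (_ ∷ _) ()

  pathFromTo⇒path : PathFromTo R u v xs → Path u v xs
  pathFromTo⇒path {xs = xs} ((_ , l , uniq) , head≡ , last≡) =
    linked⇒walk xs l head≡ last≡ , uniq

  pathWithin-[] : u ∈ zs → PathWithin zs u u (u ∷ [])
  pathWithin-[] u∈zs = ([ _ ] , All.[] ∷ []) , λ { (here refl) → u∈zs }

  pathWithin-mono : ys ⊆ zs → PathWithin ys u v xs → PathWithin zs u v xs
  pathWithin-mono ys⊆zs (p , xs⊆ys) = p , ys⊆zs ∘ xs⊆ys

  pathWithin-∷ : R u w → u ∉ zs → PathWithin zs w v xs → PathWithin (u ∷ zs) u v (u ∷ xs)
  pathWithin-∷ e u∉zs ((p , uniq) , xs⊆zs) =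
    (e ∷ p , unique-∷ (u∉zs ∘ xs⊆zs) uniq) ,
    λ { (here refl) → here refl ; (there x∈) → there (xs⊆zs x∈) }

  pathWithin-∷ʳ : R w v → v ∉ zs → PathWithin zs u w xs → PathWithin (v ∷ zs) u v (xs ∷ʳ v)
  pathWithin-∷ʳ {xs = xs} e v∉zs ((p , uniq) , xs⊆zs) =
    (walk-∷ʳ p e , unique-∷ʳ (v∉zs ∘ xs⊆zs) uniq) ,
    λ x∈ → Sum.[ there ∘ xs⊆zs , (λ { (here refl) → here refl }) ] (∈-++⁻ xs x∈)

  belowWithin-∷ : R u w → u ∉ zs → BelowWithin zs w a b → BelowWithin (u ∷ zs) u a b
  belowWithin-∷ e u∉zs (xs , p , a∈xs) = _ , pathWithin-∷ e u∉zs p , there a∈xs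

  belowWithin⇒belowFrom : BelowWithin zs a b m → BelowFrom R a b m
  belowWithin⇒belowFrom (xs , (p , _) , b∈xs) = xs , path⇒pathFromTo p , b∈xs

  prefix : Walk u v xs → Unique xs → m ∈ xs → ∃ (PathWithin xs u m)
  prefix p _ (here refl) with refl ← walk-start p = _ , pathWithin-[] (here refl)
  prefix (e ∷ p) uq@(_ ∷ uniq) (there m∈) with _ , q ← prefix p uniq m∈ =
    _ , pathWithin-∷ e (Unique[x∷xs]⇒x∉xs uq) q

  module _ (R-sym : Symmetric R) where

    suffix : Walk u v xs → Unique xs → z ∈ xs → ∃ (PathWithin xs z u)
    suffix p _ (here refl) with refl ← walk-start p = _ , pathWithin-[] (here refl)
    suffix (e ∷ p) uq@(_ ∷ uniq) (there z∈) with _ , q ← suffix p uniq z∈ =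
      _ , pathWithin-∷ʳ (R-sym e) (Unique[x∷xs]⇒x∉xs uq) q

    path⇒connectedIn : Path u v xs → ConnectedIn xs
    path⇒connectedIn (p , uniq) (here refl) m∈ with refl ← walk-start p = prefix p uniq m∈
    path⇒connectedIn (p , uniq) z∈ (here refl) with refl ← walk-start p = suffix p uniq z∈
    path⇒connectedIn ([ _ ] , _) (there ()) (there _)
    path⇒connectedIn (_ ∷ p , _ ∷ uniq) (there z∈) (there m∈)
      with _ , q ← path⇒connectedIn (p , uniq) z∈ m∈ = _ , pathWithin-mono there q

  comparable-within : Walk u v xs → Unique xs → a ∈ xs → b ∈ xs →
                      BelowWithin xs u a b ⊎ BelowWithin xs u b a
  comparable-within p uniq (here refl) b∈
    with refl ← walk-start p | ps , q ← prefix p uniq b∈ =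
    inj₁ (ps , q , walk-head (proj₁ (proj₁ q)))
  comparable-within p uniq a∈ (here refl)
    with refl ← walk-start p | ps , q ← prefix p uniq a∈ =
    inj₂ (ps , q , walk-head (proj₁ (proj₁ q)))
  comparable-within [ _ ] _ (there ()) (there _)
  comparable-within (e ∷ p) uq@(_ ∷ uniq) (there a∈) (there b∈) =
    Sum.map (belowWithin-∷ e u∉xs) (belowWithin-∷ e u∉xs) (comparable-within p uniq a∈ b∈)
    where u∉xs = Unique[x∷xs]⇒x∉xs uq

  module _ (_≟_ : DecidableEquality A) {ys : List A} (ys-connected : ConnectedIn ys) where
    open DecMembership _≟_ using (_∈?_)

    -- z is the first vertex of xs in ys, so the part of xs before z avoids ys.
    first-entry : Walk u v xs → Unique xs → v ∈ ys → m ∈ ys →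
                 ∃ λ z → z ∈ ys × z ∈ xs × BelowWithin (xs ++ ys) u z m
    first-entry {u} {xs = xs} p uniq v∈ m∈ with u ∈? ys
    ... | yes u∈ with qs , q ← ys-connected u∈ m∈ =
      u , u∈ , walk-head p , qs , pathWithin-mono (∈-++⁺ʳ xs) q , walk-head (proj₁ (proj₁ q))
    first-entry [ _ ] _ v∈ _ | no u∉ = ⊥-elim (u∉ v∈)
    first-entry (e ∷ p) uq@(_ ∷ uniq) v∈ m∈ | no u∉ys
      with z , z∈ys , z∈ , below ← first-entry p uniq v∈ m∈ =
      z , z∈ys , there z∈ , belowWithin-∷ e (∉-++ _ (Unique[x∷xs]⇒x∉xs uq) u∉ys) below

  module _ (_≟_ : DecidableEquality A) (R-sym : Symmetric R) {root : A} where

    minimal∈path : Path root v xs → IsPathVertexSet R S → S v → IsMinimalFrom root S m → m ∈ xs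
    minimal∈path {xs = xs} (p , uniq) (ys , ys-path , S⇔∈ys) Sv (Sm , minimal)
      with _ , _ , q ← isPath⇒path ys-path
      with z , z∈ys , z∈xs , below ← first-entry _≟_ (path⇒connectedIn R-sym q) p uniq
                                        (proj₁ (S⇔∈ys _) Sv) (proj₁ (S⇔∈ys _) Sm) =
      subst (_∈ xs) (minimal z (proj₂ (S⇔∈ys z) z∈ys) (belowWithin⇒belowFrom below)) z∈xs

    minimal-comparable : Connected R → IsPathVertexSet R S₁ → IsPathVertexSet R S₂ → S₁ v → S₂ v →
                         IsMinimalFrom root S₁ a → IsMinimalFrom root S₂ b →
                         BelowFrom R root a b ⊎ BelowFrom R root b a
    minimal-comparable {v = v} connected P₁ P₂ S₁v S₂v min₁ min₂
      with _ , root-path ← connected root v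
      with p , uniq ← pathFromTo⇒path root-path =
      Sum.map belowWithin⇒belowFrom belowWithin⇒belowFrom
        (comparable-within p uniq (minimal∈path (p , uniq) P₁ S₁v min₁)
                                  (minimal∈path (p , uniq) P₂ S₂v min₂))

open Walks using (IsMinimalFrom; minimal-comparable)

module _ {nH nV} (G : RootedTPIG nH nV) where
  open RootedTPIG G

  minΓH⇒minimal : ∀ {h a} → IsMinΓ G (inj₁ h) (inj₂ a) → IsMinimalFrom AdjV vroot (E h) a
  minΓH⇒minimal (Eha , minimal) = Eha , λ v Ehv v≼a → inj₂-injective (minimal (inj₂ v) Ehv v≼a)

  minΓV⇒minimal : ∀ {v a} → IsMinΓ G (inj₂ v) (inj₁ a) → IsMinimalFrom AdjH hroot (λ h → E h v) a
  minΓV⇒minimal (Eav , minimal) = Eav , λ h Ehv h≼a → inj₁-injective (minimal (inj₁ h) Ehv h≼a)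

lemma8 : ∀ {nH nV} (G : RootedTPIG nH nV) (s₁ s₂ m₁ m₂ : Vertex nH nV) →
           (∃ λ x → Γ G s₁ x × Γ G s₂ x) →
           IsMinΓ G s₁ m₁ → IsMinΓ G s₂ m₂ →
           Comparable G m₁ m₂
lemma8 G (inj₁ h₁) (inj₁ h₂) (inj₂ _) (inj₂ _) (inj₂ _ , e₁ , e₂) min₁ min₂ =
  minimal-comparable AdjV _≟ᶠ_ (adj-sym treeV) (connected treeV)
    (ΓH-path h₁) (ΓH-path h₂) e₁ e₂ (minΓH⇒minimal G min₁) (minΓH⇒minimal G min₂)
  where open RootedTPIG G; open IsTree
lemma8 G (inj₂ v₁) (inj₂ v₂) (inj₁ _) (inj₁ _) (inj₁ _ , e₁ , e₂) min₁ min₂ =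
  minimal-comparable AdjH _≟ᶠ_ (adj-sym treeH) (connected treeH)
    (ΓV-path v₁) (ΓV-path v₂) e₁ e₂ (minΓV⇒minimal G min₁) (minΓV⇒minimal G min₂)
  where open RootedTPIG G; open IsTree
lemma8 G (inj₁ _) _        (inj₁ _) _        _                 (() , _) _
lemma8 G (inj₂ _) _        (inj₂ _) _        _                 (() , _) _
lemma8 G _        (inj₁ _) _        (inj₁ _) _                 _        (() , _)
lemma8 G _        (inj₂ _) _        (inj₂ _) _                 _        (() , _)
lemma8 G (inj₁ _) _        _        _        (inj₁ _ , () , _) _        _
lemma8 G (inj₂ _) _        _        _        (inj₂ _ , () , _) _        _
lemma8 G (inj₁ _) (inj₂ _) _        _        (inj₂ _ , _ , ()) _        _
lemma8 G (inj₂ _) (inj₁ _) _        _        (inj₁ _ , _ , ()) _        _
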